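{- Consider strings $X,Y\in \Sigma^*$ and alignments $\mathcal{A} : X(i\,.\,.\,j]\twoheadrightarrow Y$ and $\mathcal{A}':X(i'\,.\,.\,j']\twoheadrightarrow Y$. If $\mathcal{A} \cap \mathcal{A}' = \emptyset$, then \[ |\mathsf{LZ}(X(\hat{\imath} \,.\,.\, \hat{\jmath}])| \le |i-i'| + 2\,\mathsf{ed}_{\mathcal{A}}(X(i\,.\,.\,j],Y) + 2\,\mathsf{ed}_{\mathcal{A}'}(X(i'\,.\,.\,j'],Y) + 1\] holds for every fragment $X(\hat{\imath} \,.\,.\, \hat{\jmath}]$ of $X$ with $\min\{i,i'\}\le \hat{\imath} \le \hat{\jmath} \le \max\{j,j'\}$.
   Context: $X(i\,.\,.\,j]$ denotes the fragment $X[i+1]\cdots X[j]$ for $0\le i\le j\le|X|$; $Y$ stands for $Y(0\,.\,.\,|Y|]$. An alignment $\mathcal{A}:X(x\,.\,.\,x']\twoheadrightarrow Y(y\,.\,.\,y']$ is a sequence $(x_t,y_t)_{t=0}^m$ of integer pairs with $(x_0,y_0)=(x,y)$, $(x_m,y_m)=(x',y')$, and $(x_t,y_t)\in\{(x_{t-1}+1,y_{t-1}+1),(x_{t-1}+1,y_{t-1}),(x_{t-1},y_{t-1}+1)\}$ for $t\in[1\,.\,.\,m]$; it is regarded as a set of pairs when taking intersections. A step of the first kind aligns $X[x_t]$ with $Y[y_t]$ (a match if these characters are equal, a substitution otherwise), of the second kind deletes $X[x_t]$, of the third inserts $Y[y_t]$. The cost $\mathsf{ed}_{\mathcal{A}}(X(x\,.\,.\,x'],Y(y\,.\,.\,y'])$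 is the number of insertions, deletions and substitutions. $\mathsf{LZ}(S)$ is the LZ77 factorization of $S$: greedy left-to-right parsing where each phrase is the longest fragment starting at the current position that also occurs starting at an earlier position (occurrences may overlap), or a single character if no such nonempty fragment exists; $|\mathsf{LZ}(S)|$ is the number of phrases. -}

module Defs where

open import Data.Nat using (ℕ; zero; suc; _+_; _∸_; _≤_; _<_)
open import Data.List using (List; []; _∷_; length; take; drop)
open import Data.Maybe using (Maybe; just; nothing)
open import Data.Maybe.Properties using () renaming (≡-dec to ≡-decᴹ)
open import Data.Product using (Σ; _×_)
open import Data.Sum using (_⊎_)
open import Data.Empty using (⊥)
open import Relation.Binary.Definitions using (DecidableEquality)
open import Relation.Binary.PropositionalEquality using (_≡_)
open import Relation.Nullary using (yes; no)

-- 0-based character access: at S k = S[k+1] in the paper's 1-based notation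
at : {A : Set} → List A → ℕ → Maybe A
at []       _       = nothing
at (a ∷ as) zero    = just a
at (a ∷ as) (suc k) = at as k

-- fragment X(i .. j] = X[i+1] ⋯ X[j]
frag : {A : Set} → List A → ℕ → ℕ → List A
frag X i j = take (j ∸ i) (drop i X)

-- An alignment  X(x .. x'] ↠ Y(y .. y']  : the sequence (x_t,y_t) from (x,y) to (x',y')
data Alignment : ℕ → ℕ → ℕ → ℕ → Set where
  stop  : ∀ {x y} → Alignment x y x y
  diag  : ∀ {x y x' y'} → Alignment (suc x) (suc y) x' y' → Alignment x y x' y'
  del   : ∀ {x y x' y'} → Alignment (suc x) y x' y' → Alignment x y x' y'
  ins   : ∀ {x y x' y'} → Alignment x (suc y) x' y' → Alignment x y x' y'

data _∈A_ (ab : ℕ × ℕ) : ∀ {x y x' y'} → Alignment x y x' y' → Set where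
  here-stop : ∀ {x y} → ab ≡ (x Data.Product., y) → ab ∈A stop {x} {y}
  here-diag : ∀ {x y x' y'} {r : Alignment (suc x) (suc y) x' y'} → ab ≡ (x Data.Product., y) → ab ∈A diag r
  here-del  : ∀ {x y x' y'} {r : Alignment (suc x) y x' y'} → ab ≡ (x Data.Product., y) → ab ∈A del r
  here-ins  : ∀ {x y x' y'} {r : Alignment x (suc y) x' y'} → ab ≡ (x Data.Product., y) → ab ∈A ins r
  there-diag : ∀ {x y x' y'} {r : Alignment (suc x) (suc y) x' y'} → ab ∈A r → ab ∈A diag r
  there-del  : ∀ {x y x' y'} {r : Alignment (suc x) y x' y'} → ab ∈A r → ab ∈A del r
  there-ins  : ∀ {x y x' y'} {r : Alignment x (suc y) x' y'} → ab ∈A r → ab ∈A ins r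

-- cost ed_A(X(x..x'], Y(y..y']): insertions + deletions + substitutions
-- (a diagonal step from (x,y) aligns X[x+1] with Y[y+1], i.e. at X x with at Y y)
edA : {A : Set} → DecidableEquality A → (X Y : List A) →
      ∀ {x y x' y'} → Alignment x y x' y' → ℕ
edA _≟_ X Y stop = 0
edA _≟_ X Y (diag {x} {y} r) with ≡-decᴹ _≟_ (at X x) (at Y y)
... | yes _ = edA _≟_ X Y r
... | no  _ = suc (edA _≟_ X Y r)
edA _≟_ X Y (del r) = suc (edA _≟_ X Y r)
edA _≟_ X Y (ins r) = suc (edA _≟_ X Y r)

-- the fragment of S of length ℓ starting at (0-based) position p also occurs
-- starting at an earlier position q < p (occurrences may overlap)
OccursEarlier : {A : Set} → List A → ℕ → ℕ → Set
OccursEarlier S p ℓ = Σ ℕ λ q → q < p × (∀ k → k < ℓ → at S (q + k) ≡ at S (p + k))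

IsPhraseLen : {A : Set} → List A → ℕ → ℕ → Set
IsPhraseLen S p ℓ =
  1 ≤ ℓ × p + ℓ ≤ length S × (ℓ ≡ 1 ⊎ OccursEarlier S p ℓ)
  × (∀ ℓ' → p + ℓ' ≤ length S → OccursEarlier S p ℓ' → ℓ' ≤ ℓ)

-- LZParse S p n : the greedy LZ77 parsing of the suffix of S starting at position p
-- (continuing the parse of S) consists of n phrases
data LZParse {A : Set} (S : List A) : ℕ → ℕ → Set where
  done : LZParse S (length S) 0
  step : ∀ {p ℓ n} → p < length S → IsPhraseLen S p ℓ → LZParse S (p + ℓ) n → LZParse S p (suc n)

LZSize : {A : Set} → List A → ℕ → Set
LZSize S n = LZParse S 0 n

-- Suppose i < i' (i = i' would make both alignments start at (i , 0)). Being disjoint, the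
-- alignment A stays strictly left of A' in every row of Y. Follow A' from column i': a column a
-- it consumes either costs A' an edit, or is matched to a character Y[b] that A also reaches in
-- row b from a column s < a; if A matches Y[b] too, then X[a] = X[s] is a copy of an earlier
-- character, and while both alignments keep moving diagonally on matches the copy extends at
-- the same offset. So a new phrase is needed only at the columns before i', at the start, and
-- after each edit of A or A' (at most two per edit), and the greedy LZ77 parsing uses no more
-- phrases than any factorisation into single characters and earlier-occurring factors.
module Submission where

open import Defs
open import Data.Nat
  using (ℕ; zero; suc; _+_; _*_; _∸_; _≤_; _<_; _⊓_; _⊔_; ∣_-_∣; z≤n; s≤s; s≤s⁻¹; _≤?_)
  renaming (_≟_ to _≟ℕ_)
open import Data.Nat.Properties hiding (_≟_)
open import Data.List using (List; []; _∷_; length; take; drop)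
open import Data.List.Properties using (length-take; length-drop)
open import Data.Maybe using (Maybe; just; nothing)
open import Data.Maybe.Properties using () renaming (≡-dec to ≡-decᴹ)
open import Data.Product using (Σ; ∃; _×_; _,_)
open import Data.Sum using (_⊎_; inj₁; inj₂)
open import Data.Empty using (⊥; ⊥-elim)
open import Relation.Binary.Definitions using (DecidableEquality; tri<; tri≈; tri>)
open import Relation.Binary.PropositionalEquality
open import Relation.Nullary using (Dec; yes; no)
open import Relation.Nullary.Decidable using (map′)
open import Data.Nat.Tactic.RingSolver using (solve-∀)

greatestUpTo : {P : ℕ → Set} → (∀ n → Dec (P n)) → ∀ M →
  Σ ℕ λ ℓ → ℓ ≤ M × (ℓ ≡ 0 ⊎ P ℓ) × (∀ ℓ' → ℓ' ≤ M → P ℓ' → ℓ' ≤ ℓ)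
greatestUpTo P? zero = 0 , z≤n , inj₁ refl , λ _ ℓ'≤0 _ → ℓ'≤0
greatestUpTo P? (suc M) with P? (suc M) | greatestUpTo P? M
... | yes P[1+M] | _ = suc M , ≤-refl , inj₂ P[1+M] , λ _ ℓ'≤1+M _ → ℓ'≤1+M
... | no ¬P[1+M] | ℓ , ℓ≤M , ok , greatest = ℓ , m≤n⇒m≤1+n ℓ≤M , ok , greatest′
  where
  greatest′ : ∀ ℓ' → ℓ' ≤ suc M → _ → ℓ' ≤ ℓ
  greatest′ ℓ' ℓ'≤1+M Pℓ' with m≤n⇒m<n∨m≡n ℓ'≤1+M
  ... | inj₁ ℓ'<1+M = greatest ℓ' (s≤s⁻¹ ℓ'<1+M) Pℓ'
  ... | inj₂ refl   = ⊥-elim (¬P[1+M] Pℓ')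

at-take : {A : Set} (n : ℕ) (L : List A) (k : ℕ) → k < n → at (take n L) k ≡ at L k
at-take (suc n) []      k       _         = refl
at-take (suc n) (x ∷ L) zero    _         = refl
at-take (suc n) (x ∷ L) (suc k) (s≤s k<n) = at-take n L k k<n

at-drop : {A : Set} (i : ℕ) (L : List A) (k : ℕ) → at (drop i L) k ≡ at L (i + k)
at-drop zero    L       k = refl
at-drop (suc i) []      k = refl
at-drop (suc i) (x ∷ L) k = at-drop i L k

at-frag : {A : Set} (X : List A) {i j x : ℕ} → i ≤ x → x < j → at (frag X i j) (x ∸ i) ≡ at X x
at-frag X {i} {j} {x} i≤x x<j = begin
  at (take (j ∸ i) (drop i X)) (x ∸ i) ≡⟨ at-take (j ∸ i) (drop i X) (x ∸ i) (∸-monoˡ-< x<j i≤x) ⟩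
  at (drop i X) (x ∸ i)                ≡⟨ at-drop i X (x ∸ i) ⟩
  at X (i + (x ∸ i))                   ≡⟨ cong (at X) (m+[n∸m]≡n i≤x) ⟩
  at X x                               ∎
  where open ≡-Reasoning

length-frag : {A : Set} (X : List A) {i j : ℕ} → j ≤ length X → length (frag X i j) ≡ j ∸ i
length-frag X {i} {j} j≤|X| = begin
  length (take (j ∸ i) (drop i X)) ≡⟨ length-take (j ∸ i) (drop i X) ⟩
  (j ∸ i) ⊓ length (drop i X)      ≡⟨ cong ((j ∸ i) ⊓_) (length-drop i X) ⟩
  (j ∸ i) ⊓ (length X ∸ i)         ≡⟨ m≤n⇒m⊓n≡m (∸-monoˡ-≤ i j≤|X|) ⟩
  j ∸ i                            ∎
  where open ≡-Reasoning

module LZ77 {A : Set} (_≟_ : DecidableEquality A) (S : List A) where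

  Agrees : ℕ → ℕ → ℕ → Set
  Agrees q p ℓ = ∀ k → k < ℓ → at S (q + k) ≡ at S (p + k)

  agrees? : ∀ q p ℓ → Dec (Agrees q p ℓ)
  agrees? q p ℓ = map′ (λ h k → h {k}) (λ h {k} → h k)
    (allUpTo? (λ k → ≡-decᴹ _≟_ (at S (q + k)) (at S (p + k))) ℓ)

  occursEarlier? : ∀ p ℓ → Dec (OccursEarlier S p ℓ)
  occursEarlier? p ℓ = anyUpTo? (λ q → agrees? q p ℓ) p

  occursEarlier-suffix : ∀ {p} d {ℓ} → OccursEarlier S p (d + ℓ) → OccursEarlier S (p + d) ℓ
  occursEarlier-suffix {p} d (q , q<p , agree) = q + d , +-monoˡ-< d q<p , λ k k<ℓ →
    subst₂ (λ u v → at S u ≡ at S v) (sym (+-assoc q d k)) (sym (+-assoc p d k))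
      (agree (d + k) (+-monoʳ-< d k<ℓ))

  fits⇒≤ : ∀ {p ℓ} → p + ℓ ≤ length S → ℓ ≤ length S ∸ p
  fits⇒≤ {p} {ℓ} fits = subst (_≤ length S ∸ p) (m+n∸m≡n p ℓ) (∸-monoˡ-≤ p fits)

  lzPhrase : ∀ p → p < length S → ∃ (IsPhraseLen S p)
  lzPhrase p p<|S| with greatestUpTo (occursEarlier? p) (length S ∸ p)
  ... | zero , _ , _ , greatest =
    1 , ≤-refl , subst (_≤ length S) (+-comm 1 p) p<|S| , inj₁ refl ,
    λ ℓ' fits occ → ≤-trans (greatest ℓ' (fits⇒≤ fits) occ) z≤n
  ... | suc ℓ , ℓ<|S|-p , inj₂ occ , greatest =
    suc ℓ , s≤s z≤n , ≤-trans (+-monoʳ-≤ p ℓ<|S|-p) (≤-reflexive (m+[n∸m]≡n (<⇒≤ p<|S|))) , inj₂ occ ,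
    λ ℓ' fits occ' → greatest ℓ' (fits⇒≤ fits) occ'

  data Factorization : ℕ → ℕ → Set where
    done   : Factorization (length S) 0
    phrase : ∀ {p ℓ n} → (ℓ ≡ 1 ⊎ OccursEarlier S p ℓ) → Factorization (p + ℓ) n →
             Factorization p (suc n)

  factorization-≤ : ∀ {p n} → Factorization p n → p ≤ length S
  factorization-≤ done = ≤-refl
  factorization-≤ (phrase {p} {ℓ} _ f) = ≤-trans (m≤m+n p ℓ) (factorization-≤ f)

  -- Every suffix of an earlier-occurring factor occurs earlier, so a greedy phrase
  -- starting inside such a factor cannot stop before its end.
  lzPhrase-reaches : ∀ {p ℓ p' L} → p ≤ p' → p' < p + ℓ → (ℓ ≡ 1 ⊎ OccursEarlier S p ℓ) →
    p + ℓ ≤ length S → IsPhraseLen S p' L → p + ℓ ≤ p' + L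
  lzPhrase-reaches {p} {ℓ} p≤p' p'<p+ℓ ok fits isPhrase with m≤n⇒∃[o]m+o≡n p≤p'
  ... | d , refl = reaches (+-cancelˡ-< p d ℓ p'<p+ℓ) ok isPhrase
    where
    split : d ≤ ℓ → p + ℓ ≡ p + d + (ℓ ∸ d)
    split d≤ℓ = trans (cong (p +_) (sym (m+[n∸m]≡n d≤ℓ))) (sym (+-assoc p d (ℓ ∸ d)))
    reaches : ∀ {L} → d < ℓ → (ℓ ≡ 1 ⊎ OccursEarlier S p ℓ) → IsPhraseLen S (p + d) L → p + ℓ ≤ p + d + L
    reaches d<ℓ (inj₁ refl) (1≤L , _) = ≤-trans (+-monoˡ-≤ 1 (m≤m+n p d)) (+-monoʳ-≤ (p + d) 1≤L)
    reaches d<ℓ (inj₂ occ) (_ , _ , _ , longest) =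
      ≤-trans (≤-reflexive (split (<⇒≤ d<ℓ))) (+-monoʳ-≤ (p + d)
        (longest (ℓ ∸ d) (subst (_≤ length S) (split (<⇒≤ d<ℓ)) fits)
          (occursEarlier-suffix d (subst (OccursEarlier S p) (sym (m+[n∸m]≡n (<⇒≤ d<ℓ))) occ))))

  lzParse-optimal : ∀ {p n} → Factorization p n → ∀ p' → p ≤ p' → p' ≤ length S →
    ∃ λ n' → LZParse S p' n' × n' ≤ n
  lzParse-optimal done p' |S|≤p' p'≤|S| =
    0 , subst (λ p → LZParse S p 0) (≤-antisym |S|≤p' p'≤|S|) done , z≤n
  lzParse-optimal (phrase {p} {ℓ} ok f) p' p≤p' p'≤|S| with p' ≟ℕ length S | p + ℓ ≤? p'
  ... | yes refl | _ = 0 , done , z≤n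
  ... | no _ | yes p+ℓ≤p' with lzParse-optimal f p' p+ℓ≤p' p'≤|S|
  ...   | n' , parse , n'≤n = n' , parse , m≤n⇒m≤1+n n'≤n
  lzParse-optimal (phrase {p} {ℓ} ok f) p' p≤p' p'≤|S| | no p'≢|S| | no p+ℓ≰p'
    with lzPhrase p' (≤∧≢⇒< p'≤|S| p'≢|S|)
  ... | L , isPhrase@(_ , p'+L≤|S| , _)
    with lzParse-optimal f (p' + L)
           (lzPhrase-reaches p≤p' (≰⇒> p+ℓ≰p') ok (factorization-≤ f) isPhrase) p'+L≤|S|
  ... | n' , parse , n'≤n = suc n' , step (≤∧≢⇒< p'≤|S| p'≢|S|) isPhrase parse , s≤s n'≤n

  -- CopyRuns (just q) p n : from position p the text continues an open phrase by
  -- copying from q onwards (possibly for zero characters), followed by n phrases.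
  data CopyRuns : Maybe ℕ → ℕ → ℕ → Set where
    end     : ∀ {src} → CopyRuns src (length S) 0
    literal : ∀ {src p n} → CopyRuns nothing (suc p) n → CopyRuns src p (suc n)
    copy    : ∀ {src p q n} → q < p → at S q ≡ at S p → CopyRuns (just (suc q)) (suc p) n →
              CopyRuns src p (suc n)
    extend  : ∀ {p q n} → at S q ≡ at S p → CopyRuns (just (suc q)) (suc p) n → CopyRuns (just q) p n

  OpenRun : Maybe ℕ → ℕ → ℕ → Set
  OpenRun nothing  p ℓ = ℓ ≡ 0
  OpenRun (just q) p ℓ = Agrees q p ℓ

  openRun-empty : ∀ src p → OpenRun src p 0
  openRun-empty nothing  p = refl
  openRun-empty (just q) p k ()

  agrees-∷ : ∀ {q p ℓ} → at S q ≡ at S p → Agrees (suc q) (suc p) ℓ → Agrees q p (suc ℓ)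
  agrees-∷ {q} {p} head≡ tail≡ zero    _         = subst₂ (λ u v → at S u ≡ at S v)
                                                    (sym (+-identityʳ q)) (sym (+-identityʳ p)) head≡
  agrees-∷ {q} {p} head≡ tail≡ (suc k) (s≤s k<ℓ) = subst₂ (λ u v → at S u ≡ at S v)
                                                    (sym (+-suc q k)) (sym (+-suc p k)) (tail≡ k k<ℓ)

  copyRuns⇒factorization : ∀ {src p n} → CopyRuns src p n → ∃ λ ℓ → OpenRun src p ℓ × Factorization (p + ℓ) n
  copyRuns⇒factorization {src} {p} end =
    0 , openRun-empty src p , subst (λ x → Factorization x 0) (sym (+-identityʳ p)) done
  copyRuns⇒factorization {src} {p} (literal {n = n} r) with copyRuns⇒factorization r
  ... | .0 , refl , f = 0 , openRun-empty src p , subst (λ x → Factorization x (suc n)) (sym (+-identityʳ p))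
    (phrase (inj₁ refl) (subst (λ x → Factorization x n) (trans (+-identityʳ (suc p)) (+-comm 1 p)) f))
  copyRuns⇒factorization {src} {p} (copy {n = n} q<p head≡ r) with copyRuns⇒factorization r
  ... | ℓ , tail≡ , f = 0 , openRun-empty src p , subst (λ x → Factorization x (suc n)) (sym (+-identityʳ p))
    (phrase (inj₂ (_ , q<p , agrees-∷ head≡ tail≡)) (subst (λ x → Factorization x n) (sym (+-suc p ℓ)) f))
  copyRuns⇒factorization {p = p} (extend {n = n} head≡ r) with copyRuns⇒factorization r
  ... | ℓ , tail≡ , f = suc ℓ , agrees-∷ head≡ tail≡ , subst (λ x → Factorization x n) (sym (+-suc p ℓ)) f

  lzSize-≤-copyRuns : ∀ {n} → CopyRuns nothing 0 n → ∃ λ n' → LZSize S n' × n' ≤ n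
  lzSize-≤-copyRuns r with copyRuns⇒factorization r
  ... | .0 , refl , f = lzParse-optimal f 0 z≤n z≤n

  literals : ∀ k {p n} → CopyRuns nothing (p + k) n → CopyRuns nothing p (k + n)
  literals zero    {p} {n} r = subst (λ x → CopyRuns nothing x n) (+-identityʳ p) r
  literals (suc k) {p} {n} r = literal (literals k (subst (λ x → CopyRuns nothing x n) (+-suc p k) r))

_⊆A_ : ∀ {x y x' y' u v u' v'} → Alignment x y x' y' → Alignment u v u' v' → Set
𝒜 ⊆A ℬ = ∀ a b → (a , b) ∈A 𝒜 → (a , b) ∈A ℬ

Disjoint : ∀ {x y x' y' u v u' v'} → Alignment x y x' y' → Alignment u v u' v' → Set
Disjoint 𝒜 ℬ = ∀ a b → (a , b) ∈A 𝒜 → (a , b) ∈A ℬ → ⊥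

disjoint-⊆ : ∀ {x y x' y' u v u' v' p q p' q' r t r' t'}
  {𝒜 : Alignment x y x' y'} {ℬ : Alignment u v u' v'} {𝒜₀ : Alignment p q p' q'} {ℬ₀ : Alignment r t r' t'} →
  𝒜₀ ⊆A 𝒜 → ℬ₀ ⊆A ℬ → Disjoint 𝒜 ℬ → Disjoint 𝒜₀ ℬ₀
disjoint-⊆ 𝒜₀⊆𝒜 ℬ₀⊆ℬ dis a b a∈𝒜₀ a∈ℬ₀ = dis a b (𝒜₀⊆𝒜 a b a∈𝒜₀) (ℬ₀⊆ℬ a b a∈ℬ₀)

start∈ : ∀ {x y x' y'} (𝒜 : Alignment x y x' y') → (x , y) ∈A 𝒜
start∈ stop     = here-stop refl
start∈ (diag 𝒜) = here-diag refl
start∈ (del 𝒜)  = here-del refl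
start∈ (ins 𝒜)  = here-ins refl

row≤ : ∀ {x y x' y'} → Alignment x y x' y' → y ≤ y'
row≤ stop     = ≤-refl
row≤ (diag 𝒜) = ≤-trans (n≤1+n _) (row≤ 𝒜)
row≤ (del 𝒜)  = row≤ 𝒜
row≤ (ins 𝒜)  = ≤-trans (n≤1+n _) (row≤ 𝒜)

end<-avoided : ∀ {s b j a} (𝒜 : Alignment s b j b) → s < a → ((a , b) ∈A 𝒜 → ⊥) → j < a
end<-avoided stop     s<a _ = s<a
end<-avoided (diag 𝒜) _   _ = ⊥-elim (<-irrefl refl (row≤ 𝒜))
end<-avoided (ins 𝒜)  _   _ = ⊥-elim (<-irrefl refl (row≤ 𝒜))
end<-avoided {s} {a = a} (del 𝒜) s<a avoid with suc s ≟ℕ a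
... | yes refl = ⊥-elim (avoid (there-del (start∈ 𝒜)))
... | no 1+s≢a = end<-avoided 𝒜 (≤∧≢⇒< s<a 1+s≢a) (λ a∈𝒜 → avoid (there-del a∈𝒜))

module Edits {A : Set} (_≟_ : DecidableEquality A) (X Y : List A) where

  ed : ∀ {x y x' y'} → Alignment x y x' y' → ℕ
  ed = edA _≟_ X Y

  diag-cost : ∀ {x y x' y'} (𝒜 : Alignment (suc x) (suc y) x' y') →
    (at X x ≡ at Y y × ed (diag 𝒜) ≡ ed 𝒜) ⊎ ed (diag 𝒜) ≡ suc (ed 𝒜)
  diag-cost {x} {y} 𝒜 with ≡-decᴹ _≟_ (at X x) (at Y y)
  ... | yes x≡y = inj₁ (x≡y , refl)
  ... | no _    = inj₂ refl

  ed≤ed-diag : ∀ {x y x' y'} (𝒜 : Alignment (suc x) (suc y) x' y') → ed 𝒜 ≤ ed (diag 𝒜)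
  ed≤ed-diag 𝒜 with diag-cost 𝒜
  ... | inj₁ (_ , ed≡) = ≤-reflexive (sym ed≡)
  ... | inj₂ ed≡       = ≤-trans (n≤1+n _) (≤-reflexive (sym ed≡))

  record RowExit {s b j m} (𝒜 : Alignment s b j m) (a : ℕ) : Set where
    constructor exit
    field
      {column} : ℕ
      rest     : Alignment column (suc b) j m
      s≤column : s ≤ column
      column≤a : column ≤ a
      rest⊆𝒜   : rest ⊆A 𝒜
      cost     : (column ≡ suc s × at X s ≡ at Y b × ed rest ≡ ed 𝒜) ⊎ suc (ed rest) ≤ ed 𝒜

  rowExit : ∀ {s b j m a} (𝒜 : Alignment s b j m) → b < m → s < a → ((a , b) ∈A 𝒜 → ⊥) → RowExit 𝒜 a
  rowExit stop b<m _ _ = ⊥-elim (<-irrefl refl b<m)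
  rowExit (diag 𝒜) _ s<a _ = exit 𝒜 (n≤1+n _) s<a (λ _ _ → there-diag) cost
    where cost : _
          cost with diag-cost 𝒜
          ... | inj₁ (x≡y , ed≡) = inj₁ (refl , x≡y , sym ed≡)
          ... | inj₂ ed≡         = inj₂ (≤-reflexive (sym ed≡))
  rowExit (ins 𝒜) _ s<a _ = exit 𝒜 ≤-refl (<⇒≤ s<a) (λ _ _ → there-ins) (inj₂ ≤-refl)
  rowExit {s} {a = a} (del 𝒜) b<m s<a avoid with suc s ≟ℕ a
  ... | yes refl = ⊥-elim (avoid (there-del (start∈ 𝒜)))
  ... | no 1+s≢a with rowExit 𝒜 b<m (≤∧≢⇒< s<a 1+s≢a) (λ a∈𝒜 → avoid (there-del a∈𝒜))
  ...   | exit rest 1+s≤column column≤a rest⊆𝒜 cost =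
    exit rest (≤-trans (n≤1+n s) 1+s≤column) column≤a (λ x y x∈ → there-del (rest⊆𝒜 x y x∈)) (inj₂ (paid cost))
    where paid : _ ⊎ suc (ed rest) ≤ ed 𝒜 → suc (ed rest) ≤ suc (ed 𝒜)
          paid (inj₁ (_ , _ , ed≡)) = s≤s (≤-reflexive ed≡)
          paid (inj₂ ed<)           = m≤n⇒m≤1+n ed<

  rowExit-ed≤ : ∀ {s b j m a} {𝒜 : Alignment s b j m} (e : RowExit 𝒜 a) → ed (RowExit.rest e) ≤ ed 𝒜
  rowExit-ed≤ (exit _ _ _ _ (inj₁ (_ , _ , ed≡))) = ≤-reflexive ed≡
  rowExit-ed≤ (exit _ _ _ _ (inj₂ ed<))           = <⇒≤ ed<

  data DiagStep {a b s j j' m} (𝒜' : Alignment (suc a) (suc b) j' m) (𝒜 : Alignment s b j m) : Set where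
    copying : (rest : Alignment (suc s) (suc b) j m) → rest ⊆A 𝒜 → suc s ≤ a → at X s ≡ at X a →
              ed rest + ed 𝒜' ≤ ed 𝒜 + ed (diag 𝒜') → DiagStep 𝒜' 𝒜
    paying  : ∀ {s'} (rest : Alignment s' (suc b) j m) → rest ⊆A 𝒜 → s ≤ s' → s' ≤ a →
              suc (ed rest + ed 𝒜') ≤ ed 𝒜 + ed (diag 𝒜') → DiagStep 𝒜' 𝒜

  diagStep : ∀ {a b s j j' m} (𝒜' : Alignment (suc a) (suc b) j' m) (𝒜 : Alignment s b j m) →
    s < a → ((a , b) ∈A 𝒜 → ⊥) → DiagStep 𝒜' 𝒜
  diagStep 𝒜' 𝒜 s<a avoid with rowExit 𝒜 (row≤ 𝒜') s<a avoid | diag-cost 𝒜'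
  ... | exit rest _ s'≤a rest⊆𝒜 (inj₁ (refl , s≡y , ed≡)) | inj₁ (a≡y , ed'≡) =
    copying rest rest⊆𝒜 s'≤a (trans s≡y (sym a≡y)) (≤-reflexive (cong₂ _+_ ed≡ (sym ed'≡)))
  ... | exit rest _ s'≤a rest⊆𝒜 (inj₁ (refl , _ , ed≡)) | inj₂ ed'≡ =
    paying rest rest⊆𝒜 (n≤1+n _) s'≤a
      (≤-reflexive (trans (sym (+-suc (ed rest) (ed 𝒜'))) (cong₂ _+_ ed≡ (sym ed'≡))))
  ... | exit rest s≤s' s'≤a rest⊆𝒜 (inj₂ ed<) | _ =
    paying rest rest⊆𝒜 s≤s' s'≤a (+-mono-≤ ed< (ed≤ed-diag 𝒜'))

∸-split : ∀ {i k n} → i ≤ k → k ≤ n → (n ∸ k) + (k ∸ i) ≡ n ∸ i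
∸-split {i} {k} {n} i≤k k≤n = trans (sym (+-∸-assoc (n ∸ k) i≤k)) (cong (_∸ i) (m∸n+n≡m k≤n))

recharge₀ : ∀ {n d w w'} c ψ c' ψ' → w' ≤ w → d + (c' + ψ') ≤ c + ψ →
  n ≤ c' + ψ' + 2 * w' → d + n ≤ c + ψ + 2 * w
recharge₀ {n} {d} {w} {w'} c ψ c' ψ' w'≤w dcψ≤ n≤ = begin
  d + n                   ≤⟨ +-monoʳ-≤ d n≤ ⟩
  d + (c' + ψ' + 2 * w')  ≡⟨ +-assoc d (c' + ψ') (2 * w') ⟨
  d + (c' + ψ') + 2 * w'  ≤⟨ +-mono-≤ dcψ≤ (*-monoʳ-≤ 2 w'≤w) ⟩
  c + ψ + 2 * w           ∎
  where open ≤-Reasoning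

recharge₁ : ∀ {n d w w'} c ψ c' ψ' → suc w' ≤ w → d + (c' + ψ') ≤ 2 + (c + ψ) →
  n ≤ c' + ψ' + 2 * w' → d + n ≤ c + ψ + 2 * w
recharge₁ {n} {d} {w} {w'} c ψ c' ψ' w'<w dcψ≤ n≤ = begin
  d + n                   ≤⟨ +-monoʳ-≤ d n≤ ⟩
  d + (c' + ψ' + 2 * w')  ≡⟨ +-assoc d (c' + ψ') (2 * w') ⟨
  d + (c' + ψ') + 2 * w'  ≤⟨ +-monoˡ-≤ (2 * w') dcψ≤ ⟩
  2 + (c + ψ) + 2 * w'    ≡⟨ shift (c + ψ) w' ⟩
  c + ψ + 2 * suc w'      ≤⟨ +-monoʳ-≤ (c + ψ) (*-monoʳ-≤ 2 w'<w) ⟩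
  c + ψ + 2 * w           ∎
  where open ≤-Reasoning
        shift : ∀ x y → 2 + x + 2 * y ≡ x + 2 * suc y
        shift = solve-∀

budget-swap : ∀ d e e' → d + 2 * e + 2 * e' + 1 ≡ d + 2 * e' + 2 * e + 1
budget-swap = solve-∀

module Walk {A : Set} (_≟_ : DecidableEquality A) (X Y : List A) (î ĵ : ℕ) (ĵ≤|X| : ĵ ≤ length X) where

  open Edits _≟_ X Y

  S : List A
  S = frag X î ĵ

  open LZ77 _≟_ S

  at-S-≡ : ∀ {s a} → î ≤ s → s < a → a < ĵ → at X s ≡ at X a → at S (s ∸ î) ≡ at S (a ∸ î)
  at-S-≡ î≤s s<a a<ĵ s≡a = trans (at-frag X î≤s (<-trans s<a a<ĵ))
    (trans s≡a (sym (at-frag X (≤-trans î≤s (<⇒≤ s<a)) a<ĵ)))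

  index-inside : ∀ {a} → î ≤ a → suc a ∸ î ≡ suc (a ∸ î)
  index-inside = +-∸-assoc 1

  index-outside : ∀ {a} → a < î → suc a ∸ î ≡ a ∸ î
  index-outside a<î = trans (m≤n⇒m∸n≡0 a<î) (sym (m≤n⇒m∸n≡0 (<⇒≤ a<î)))

  -- With the right alignment at column a and the left one at column s of the same row,
  -- the columns (s .. min a î] lie before the fragment: they cannot serve as copy
  -- sources, so the walk keeps one unit of budget for each of them.
  gap : ℕ → ℕ → ℕ
  gap a s = a ⊓ î ∸ s

  gap-antimonoʳ : ∀ a {s s'} → s ≤ s' → gap a s' ≤ gap a s
  gap-antimonoʳ a = ∸-monoʳ-≤ (a ⊓ î)

  gap-inside : ∀ {a} s → î ≤ a → gap (suc a) s ≡ gap a s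
  gap-inside s î≤a = cong (_∸ s) (trans (m≥n⇒m⊓n≡n (m≤n⇒m≤1+n î≤a)) (sym (m≥n⇒m⊓n≡n î≤a)))

  gap-suc : ∀ a s → gap (suc a) s ≤ suc (gap a s)
  gap-suc a s = ≤-trans (∸-monoˡ-≤ s (⊓-monoʳ-≤ (suc a) (n≤1+n î))) (suc-∸-≤ (a ⊓ î) s)
    where suc-∸-≤ : ∀ x s → suc x ∸ s ≤ suc (x ∸ s)
          suc-∸-≤ x       zero    = ≤-refl
          suc-∸-≤ zero    (suc s) = ≤-trans (≤-reflexive (0∸n≡0 s)) z≤n
          suc-∸-≤ (suc x) (suc s) = suc-∸-≤ x s

  gap-suc-suc : ∀ a s → gap (suc a) (suc s) ≤ gap a s
  gap-suc-suc a s = ∸-monoˡ-≤ (suc s) (⊓-monoʳ-≤ (suc a) (n≤1+n î))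

  gap-shrinks : ∀ {a s} → î ≤ a → s < î → suc (gap (suc a) (suc s)) ≡ gap a s
  gap-shrinks {a} {s} î≤a s<î = begin
    suc (suc a ⊓ î ∸ suc s) ≡⟨ cong (λ x → suc (x ∸ suc s)) (m≥n⇒m⊓n≡n (m≤n⇒m≤1+n î≤a)) ⟩
    suc (î ∸ suc s)         ≡⟨ +-∸-assoc 1 s<î ⟨
    î ∸ s                   ≡⟨ cong (_∸ s) (m≥n⇒m⊓n≡n î≤a) ⟨
    a ⊓ î ∸ s               ∎
    where open ≡-Reasoning

  gap-prefix : ∀ {i i'} → i ≤ î → i ≤ i' → (i' ∸ î) + gap i' i ≡ i' ∸ i
  gap-prefix {i} {i'} i≤î i≤i' with î ≤? i'
  ... | yes î≤i' = trans (cong ((i' ∸ î) +_) (cong (_∸ i) (m≥n⇒m⊓n≡n î≤i'))) (∸-split i≤î î≤i')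
  ... | no  î≰i' = cong₂ _+_ (m≤n⇒m∸n≡0 (<⇒≤ (≰⇒> î≰i'))) (cong (_∸ i) (m≤n⇒m⊓n≡m (<⇒≤ (≰⇒> î≰i'))))

  -- In mode continuing, the current phrase copies from column s onwards and can be extended
  -- for free; in mode fresh, one unit of budget (c = 1) is reserved for opening a phrase.
  data Mode : Maybe ℕ → ℕ → ℕ → Set where
    fresh      : ∀ {src s} → Mode src s 1
    continuing : ∀ {s} → î ≤ s → Mode (just (s ∸ î)) s 0

  -- Column a of X is position a ∸ î of S: all columns before the fragment map to 0.
  Parsed : ∀ {a b s j j' m} → Alignment a b j' m → Alignment s b j m → Maybe ℕ → ℕ → Set
  Parsed {a} {s = s} 𝒜' 𝒜 src c =
    ∃ λ n → CopyRuns src (a ∸ î) n × n ≤ c + gap a s + 2 * (ed 𝒜 + ed 𝒜')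

  Continuation : ∀ {a b s j j' m} → Alignment a b j' m → Alignment s b j m → Set
  Continuation {s = s} 𝒜' 𝒜 = ∀ {src c} → Mode src s c → Parsed 𝒜' 𝒜 src c

  module _ {a b s j j' m} (𝒜' : Alignment a b j' m) (𝒜 : Alignment s b j m) where

    advance-paid : ∀ {b' s'} (𝒜'₁ : Alignment (suc a) b' j' m) (𝒜₁ : Alignment s' b' j m) →
      s < a → s ≤ s' → suc (ed 𝒜₁ + ed 𝒜'₁) ≤ ed 𝒜 + ed 𝒜' → Continuation 𝒜'₁ 𝒜₁ → Continuation 𝒜' 𝒜
    advance-paid {s' = s'} 𝒜'₁ 𝒜₁ s<a s≤s' paid next {c = c} md with î ≤? a
    ... | yes î≤a with next (fresh {src = nothing})
    ...   | n , runs , n≤ = suc n , literal (subst (λ x → CopyRuns nothing x n) (index-inside î≤a) runs) ,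
      recharge₁ c (gap a s) 1 (gap (suc a) s') paid (s≤s (s≤s (≤-trans (gap-antimonoʳ (suc a) s≤s')
        (≤-trans (≤-reflexive (gap-inside s î≤a)) (m≤n+m _ _))))) n≤
    advance-paid {s' = s'} 𝒜'₁ 𝒜₁ s<a s≤s' paid next {src} fresh | no î≰a with next (fresh {src = src})
    ... | n , runs , n≤ = n , subst (λ x → CopyRuns src x n) (index-outside (≰⇒> î≰a)) runs ,
      recharge₁ 1 (gap a s) 1 (gap (suc a) s') paid
        (s≤s (≤-trans (gap-antimonoʳ (suc a) s≤s') (m≤n⇒m≤1+n (gap-suc a s)))) n≤
    advance-paid _ _ s<a _ _ _ (continuing î≤s) | no î≰a = ⊥-elim (î≰a (≤-trans î≤s (<⇒≤ s<a)))

    stay-paid : ∀ {b' s'} (𝒜'₁ : Alignment a b' j' m) (𝒜₁ : Alignment s' b' j m) →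
      s ≤ s' → suc (ed 𝒜₁ + ed 𝒜'₁) ≤ ed 𝒜 + ed 𝒜' → Continuation 𝒜'₁ 𝒜₁ → Continuation 𝒜' 𝒜
    stay-paid {s' = s'} 𝒜'₁ 𝒜₁ s≤s' paid next {src} {c} md with next (fresh {src = src})
    ... | n , runs , n≤ = n , runs ,
      recharge₁ c (gap a s) 1 (gap a s') paid (s≤s (m≤n⇒m≤1+n (≤-trans (gap-antimonoʳ a s≤s') (m≤n+m _ _)))) n≤

    copy-step : ∀ {b'} (𝒜'₁ : Alignment (suc a) b' j' m) (𝒜₁ : Alignment (suc s) b' j m) →
      s < a → a < ĵ → at X s ≡ at X a → ed 𝒜₁ + ed 𝒜'₁ ≤ ed 𝒜 + ed 𝒜' →
      Continuation 𝒜'₁ 𝒜₁ → Continuation 𝒜' 𝒜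
    copy-step 𝒜'₁ 𝒜₁ s<a a<ĵ s≡a free next (continuing î≤s) with next (continuing (m≤n⇒m≤1+n î≤s))
    ... | n , runs , n≤ = n ,
      extend (at-S-≡ î≤s s<a a<ĵ s≡a)
        (subst₂ (λ u v → CopyRuns (just u) v n) (index-inside î≤s) (index-inside î≤a) runs) ,
      recharge₀ 0 (gap a s) 0 (gap (suc a) (suc s)) free (gap-suc-suc a s) n≤
      where î≤a = ≤-trans î≤s (<⇒≤ s<a)
    copy-step 𝒜'₁ 𝒜₁ s<a a<ĵ s≡a free next fresh with î ≤? s
    ... | yes î≤s with next (continuing (m≤n⇒m≤1+n î≤s))
    ...   | n , runs , n≤ = suc n ,
      copy (∸-monoˡ-< s<a î≤s) (at-S-≡ î≤s s<a a<ĵ s≡a)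
        (subst₂ (λ u v → CopyRuns (just u) v n) (index-inside î≤s) (index-inside î≤a) runs) ,
      recharge₀ 1 (gap a s) 0 (gap (suc a) (suc s)) free (s≤s (gap-suc-suc a s)) n≤
      where î≤a = ≤-trans î≤s (<⇒≤ s<a)
    copy-step 𝒜'₁ 𝒜₁ s<a a<ĵ s≡a free next fresh | no î≰s with î ≤? a
    ... | yes î≤a with next (fresh {src = nothing})
    ...   | n , runs , n≤ = suc n , literal (subst (λ x → CopyRuns nothing x n) (index-inside î≤a) runs) ,
      recharge₀ 1 (gap a s) 1 (gap (suc a) (suc s)) free (s≤s (≤-reflexive (gap-shrinks î≤a (≰⇒> î≰s)))) n≤
    copy-step 𝒜'₁ 𝒜₁ s<a a<ĵ s≡a free next {src} fresh | no î≰s | no î≰a with next (fresh {src = src})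
    ... | n , runs , n≤ = n , subst (λ x → CopyRuns src x n) (index-outside (≰⇒> î≰a)) runs ,
      recharge₀ 1 (gap a s) 1 (gap (suc a) (suc s)) free (s≤s (gap-suc-suc a s)) n≤

  length-S : length S ≡ ĵ ∸ î
  length-S = length-frag X {î} ĵ≤|X|

  walk : ∀ {a b s j j' m} (𝒜' : Alignment a b j' m) (𝒜 : Alignment s b j m) → Disjoint 𝒜 𝒜' →
    s < a → a ≤ ĵ → ĵ ≤ j ⊔ j' → Continuation 𝒜' 𝒜
  walk {a} 𝒜' 𝒜 dis s<a a≤ĵ ĵ≤ {src} md with a ≟ℕ ĵ
  ... | yes refl = 0 , subst (λ x → CopyRuns src x 0) length-S end , z≤n
  walk {a} {j = j} stop 𝒜 dis s<a a≤ĵ ĵ≤ md | no a≢ĵ =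
    ⊥-elim (a≢ĵ (≤-antisym a≤ĵ (≤-trans ĵ≤ (≤-reflexive (m≤n⇒m⊔n≡n (<⇒≤ j<a))))))
    where j<a = end<-avoided 𝒜 s<a (λ a∈𝒜 → dis _ _ a∈𝒜 (here-stop refl))
  walk (del 𝒜') 𝒜 dis s<a a≤ĵ ĵ≤ md | no a≢ĵ =
    advance-paid (del 𝒜') 𝒜 𝒜' 𝒜 s<a ≤-refl (≤-reflexive (sym (+-suc _ _)))
      (walk 𝒜' 𝒜 (disjoint-⊆ (λ _ _ x → x) (λ _ _ → there-del) dis) (m<n⇒m<1+n s<a) (≤∧≢⇒< a≤ĵ a≢ĵ) ĵ≤) md
  walk {a} {b} (ins 𝒜') 𝒜 dis s<a a≤ĵ ĵ≤ md | no a≢ĵ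
    with rowExit 𝒜 (row≤ 𝒜') s<a (λ a∈𝒜 → dis a b a∈𝒜 (here-ins refl))
  ... | e@(exit rest s≤s' s'≤a rest⊆𝒜 _) with RowExit.column e ≟ℕ a
  ...   | yes refl = ⊥-elim (dis _ _ (rest⊆𝒜 _ _ (start∈ rest)) (there-ins (start∈ 𝒜')))
  ...   | no s'≢a =
    stay-paid (ins 𝒜') 𝒜 𝒜' rest s≤s' (≤-trans (≤-reflexive (sym (+-suc _ _))) (+-monoˡ-≤ _ (rowExit-ed≤ e)))
      (walk 𝒜' rest (disjoint-⊆ rest⊆𝒜 (λ _ _ → there-ins) dis) (≤∧≢⇒< s'≤a s'≢a) a≤ĵ ĵ≤) md
  walk {a} {b} (diag 𝒜') 𝒜 dis s<a a≤ĵ ĵ≤ md | no a≢ĵ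
    with diagStep 𝒜' 𝒜 s<a (λ a∈𝒜 → dis a b a∈𝒜 (here-diag refl))
  ... | copying rest rest⊆𝒜 1+s≤a s≡a free =
    copy-step (diag 𝒜') 𝒜 𝒜' rest s<a a<ĵ s≡a free
      (walk 𝒜' rest (disjoint-⊆ rest⊆𝒜 (λ _ _ → there-diag) dis) (s≤s 1+s≤a) a<ĵ ĵ≤) md
    where a<ĵ = ≤∧≢⇒< a≤ĵ a≢ĵ
  ... | paying rest rest⊆𝒜 s≤s' s'≤a paid =
    advance-paid (diag 𝒜') 𝒜 𝒜' rest s<a s≤s' paid
      (walk 𝒜' rest (disjoint-⊆ rest⊆𝒜 (λ _ _ → there-diag) dis) (s≤s s'≤a) (≤∧≢⇒< a≤ĵ a≢ĵ) ĵ≤) md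

  lzSize-≤-< : ∀ {i j i' j' m} (𝒜 : Alignment i 0 j m) (𝒜' : Alignment i' 0 j' m) → Disjoint 𝒜 𝒜' →
    i < i' → i ≤ î → ĵ ≤ j ⊔ j' →
    ∃ λ n → LZSize S n × n ≤ (i' ∸ i) + 2 * ed 𝒜 + 2 * ed 𝒜' + 1
  lzSize-≤-< {i} {i' = i'} 𝒜 𝒜' dis i<i' i≤î ĵ≤ with ĵ ≤? i'
  ... | yes ĵ≤i' with lzSize-≤-copyRuns (literals (ĵ ∸ î) (subst (λ x → CopyRuns nothing x 0) length-S end))
  ...   | n , lz , n≤ = n , lz , ≤-trans n≤ (≤-trans (≤-reflexive (+-identityʳ (ĵ ∸ î)))
          (≤-trans (∸-mono ĵ≤i' i≤î) (≤-trans (m≤m+n (i' ∸ i) _) (≤-trans (m≤m+n _ _) (m≤m+n _ 1)))))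
  lzSize-≤-< {i} {i' = i'} 𝒜 𝒜' dis i<i' i≤î ĵ≤ | no ĵ≰i'
    with walk 𝒜' 𝒜 dis i<i' (<⇒≤ (≰⇒> ĵ≰i')) ĵ≤ (fresh {src = nothing})
  ... | n , runs , n≤ with lzSize-≤-copyRuns (literals (i' ∸ î) runs)
  ...   | n' , lz , n'≤ = n' , lz , (begin
    n'                                                  ≤⟨ n'≤ ⟩
    (i' ∸ î) + n                                        ≤⟨ +-monoʳ-≤ (i' ∸ î) n≤ ⟩
    (i' ∸ î) + (1 + gap i' i + 2 * (ed 𝒜 + ed 𝒜'))     ≡⟨ regroup (i' ∸ î) (gap i' i) (ed 𝒜) (ed 𝒜') ⟩
    (i' ∸ î) + gap i' i + 2 * ed 𝒜 + 2 * ed 𝒜' + 1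
      ≡⟨ cong (λ x → x + 2 * ed 𝒜 + 2 * ed 𝒜' + 1) (gap-prefix i≤î (<⇒≤ i<i')) ⟩
    (i' ∸ i) + 2 * ed 𝒜 + 2 * ed 𝒜' + 1                 ∎)
    where open ≤-Reasoning
          regroup : ∀ k g e e' → k + (1 + g + 2 * (e + e')) ≡ k + g + 2 * e + 2 * e' + 1
          regroup = solve-∀

  lzSize-≤ : ∀ {i j i' j' m} (𝒜 : Alignment i 0 j m) (𝒜' : Alignment i' 0 j' m) → Disjoint 𝒜 𝒜' →
    i ⊓ i' ≤ î → ĵ ≤ j ⊔ j' → ∃ λ n → LZSize S n × n ≤ ∣ i - i' ∣ + 2 * ed 𝒜 + 2 * ed 𝒜' + 1
  lzSize-≤ {i} {j} {i'} {j'} 𝒜 𝒜' dis i⊓i'≤î ĵ≤j⊔j' with <-cmp i i'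
  ... | tri< i<i' _ _
    with lzSize-≤-< 𝒜 𝒜' dis i<i' (subst (_≤ î) (m≤n⇒m⊓n≡m (<⇒≤ i<i')) i⊓i'≤î) ĵ≤j⊔j'
  ...   | n , lz , n≤ = n , lz , subst (λ d → n ≤ d + _ + _ + 1) (sym (m≤n⇒∣m-n∣≡n∸m (<⇒≤ i<i'))) n≤
  lzSize-≤ 𝒜 𝒜' dis _ _ | tri≈ _ refl _ = ⊥-elim (dis _ 0 (start∈ 𝒜) (start∈ 𝒜'))
  lzSize-≤ {i} {j} {i'} {j'} 𝒜 𝒜' dis i⊓i'≤î ĵ≤j⊔j' | tri> _ _ i'<i
    with lzSize-≤-< 𝒜' 𝒜 (λ a b a∈𝒜' a∈𝒜 → dis a b a∈𝒜 a∈𝒜') i'<i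
           (subst (_≤ î) (m≥n⇒m⊓n≡n (<⇒≤ i'<i)) i⊓i'≤î) (subst (ĵ ≤_) (⊔-comm j j') ĵ≤j⊔j')
  ...   | n , lz , n≤ = n , lz , subst (n ≤_) (trans (budget-swap (i ∸ i') (ed 𝒜') (ed 𝒜))
          (cong (λ d → d + _ + _ + 1) (sym (trans (∣-∣-comm i i') (m≤n⇒∣m-n∣≡n∸m (<⇒≤ i'<i)))))) n≤

lemma4p5 : {Σ' : Set} (_≟_ : DecidableEquality Σ') (X Y : List Σ') (i j i' j' : ℕ) →
    j ≤ length X → j' ≤ length X →
    (𝒜 : Alignment i 0 j (length Y)) (𝒜' : Alignment i' 0 j' (length Y)) →
    (∀ a b → (a , b) ∈A 𝒜 → (a , b) ∈A 𝒜' → ⊥) →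
    (î ĵ : ℕ) → i ⊓ i' ≤ î → î ≤ ĵ → ĵ ≤ j ⊔ j' →
    Σ ℕ λ n → LZSize (frag X î ĵ) n ×
      n ≤ ∣ i - i' ∣ + 2 * edA _≟_ X Y 𝒜 + 2 * edA _≟_ X Y 𝒜' + 1
lemma4p5 _≟_ X Y i j i' j' j≤|X| j'≤|X| 𝒜 𝒜' dis î ĵ i⊓i'≤î _ ĵ≤j⊔j' =
  Walk.lzSize-≤ _≟_ X Y î ĵ (≤-trans ĵ≤j⊔j' (⊔-lub j≤|X| j'≤|X|)) 𝒜 𝒜' dis i⊓i'≤î ĵ≤j⊔j'
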